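{- Let $m$ be a positive integer. There exists a finite set $S$ such that the complete graph $K_m$ is a sum graph over the group $(\mathcal{P}(S),\triangle)$ of subsets of $S$ with the symmetric difference operation if and only if $m=2^k-\varepsilon$ for some integer $k\geq 0$ and some $\varepsilon\in\{0,1\}$.
   Context: Given a magma $(M,\oplus)$ and a finite subset $V\subseteq M$, $\mathcal{G}_M(V)$ denotes the simple graph with vertex set $V$ in which two distinct vertices $v,w$ are adjacent if and only if $v\oplus w\in V$ or $w\oplus v\in V$. A graph $G$ is a sum graph over $M$ if $G$ is isomorphic to $\mathcal{G}_M(V)$ for some $V\subseteq M$. $A\triangle B=(A\setminus B)\cup(B\setminus A)$. -}

module Defs where

open import Level using (0ℓ)
open import Data.Nat using (ℕ; _∸_; _^_)
open import Data.Fin using (Fin)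
open import Data.Fin.Subset using (Subset; _∪_; _─_)
open import Data.List using (List; length; lookup)
open import Data.List.Membership.Propositional using (_∈_)
open import Data.List.Relation.Unary.Unique.Propositional using (Unique)
open import Data.Product using (Σ; _×_; _,_)
open import Data.Sum using (_⊎_; inj₁; inj₂)
open import Data.Empty using (⊥)
import Relation.Binary.PropositionalEquality as Eq
open import Function.Bundles using (_⤖_; _⇔_; Bijection)
open import Relation.Binary.PropositionalEquality using (_≡_; _≢_)

record Graph : Set₁ where
  field
    order : ℕ
    Adj   : Fin order → Fin order → Set
    sym   : ∀ {i j} → Adj i j → Adj j i
    irrefl : ∀ {i} → Adj i i → ⊥

open Graph public

_≅_ : Graph → Graph → Set
G ≅ H = Σ (Fin (order G) ⤖ Fin (order H)) λ f →
  ∀ i j → Adj G i j ⇔ Adj H (Bijection.to f i) (Bijection.to f j)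

K : ℕ → Graph
K m = record { order = m ; Adj = λ i j → i ≢ j
             ; sym = λ p q → p (Eq.sym q)
             ; irrefl = λ p → p Eq.refl }

-- G_M(V) for a magma (M, ⊕) (propositional equality) and a finite subset V ⊆ M,
-- V given as a duplicate-free list; vertex i corresponds to the element lookup V i.
sumGraph : {M : Set} (_⊕_ : M → M → M) (V : List M) → Unique V → Graph
sumGraph {M} _⊕_ V u = record
  { order = length V
  ; Adj = λ i j → (lookup V i ≢ lookup V j) × ((lookup V i ⊕ lookup V j) ∈ V ⊎ (lookup V j ⊕ lookup V i) ∈ V)
  ; sym = λ { (ne , inj₁ a) → (λ e → ne (Eq.sym e)) , inj₂ a
            ; (ne , inj₂ a) → (λ e → ne (Eq.sym e)) , inj₁ a }
  ; irrefl = λ { (ne , _) → ne Eq.refl } }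

IsSumGraphOver : {M : Set} (_⊕_ : M → M → M) → Graph → Set
IsSumGraphOver {M} _⊕_ G = Σ (List M) λ V → Σ (Unique V) λ u → G ≅ sumGraph _⊕_ V u

_△_ : ∀ {n} → Subset n → Subset n → Subset n
A △ B = (A ─ B) ∪ (B ─ A)

{-# OPTIONS --safe #-}
-- If K m ≅ G(V) over (𝒫(S), △), then x △ y ∈ V for any two distinct x, y ∈ V, so V ∪ {∅} is a
-- subgroup of the elementary abelian 2-group 𝒫(S) and has 2 ^ k elements; hence m = 2 ^ k or
-- m = 2 ^ k − 1 according as ∅ ∈ V or not. Conversely all subsets, resp. all nonempty subsets, of
-- S = {1, …, k} give K (2 ^ k), resp. K (2 ^ k − 1). A subgroup H is counted by splitting on the
-- first coordinate: the members with first coordinate 1 are either absent or form a translate of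
-- the members with first coordinate 0, which form a subgroup one dimension down.
module Submission where

open import Defs hiding (sym)
open import Data.Nat using (ℕ; zero; suc; _+_; _∸_; _^_; _≥_; _<_; z≤n; s≤s)
open import Data.Nat.Properties using (+-comm; +-identityʳ; +-commutativeSemigroup)
open import Algebra.Properties.CommutativeSemigroup +-commutativeSemigroup using (interchange)
open import Data.Bool using (true; false; if_then_else_) renaming (_≟_ to _≟ᵇ_)
open import Data.Product using (Σ; _×_; ∃; _,_; proj₂)
open import Data.Sum using (_⊎_; inj₁; inj₂)
open import Data.Empty using (⊥-elim)
open import Data.Vec using ([]; _∷_)
open import Data.Vec.Properties using (≡-dec; ∷-injectiveʳ)
open import Data.Fin using (zero; suc)
open import Data.Fin.Subset using (Subset; ⊥)
open import Data.Fin.Permutation using (↔⇒≡)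
open import Data.List using (List; []; _∷_; [_]; length; lookup; map; _++_)
open import Data.List.Properties using (length-++; length-map)
open import Data.List.Relation.Unary.Any using (here; there; index)
open import Data.List.Relation.Unary.Any.Properties using (lookup-index)
open import Data.List.Relation.Unary.All using ([]; _∷_)
open import Data.List.Relation.Unary.All.Properties using (All¬⇒¬Any; ¬Any⇒All¬)
open import Data.List.Relation.Unary.AllPairs using ([]; _∷_)
open import Data.List.Relation.Unary.Unique.Propositional using (Unique)
import Data.List.Relation.Unary.Unique.Propositional.Properties as Unique
open import Data.List.Membership.Propositional using (_∈_)
open import Data.List.Membership.Propositional.Properties 
  using (∈-lookup; ∈-map⁺; ∈-map⁻; ∈-++⁺ˡ; ∈-++⁺ʳ)
import Data.List.Membership.DecPropositional as DecMembership
open import Relation.Nullary using (¬_; Dec; yes; no; does; contradiction)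
open import Relation.Nullary.Decidable using (_⊎-dec_)
open import Relation.Unary using (Decidable)
open import Relation.Binary.Definitions using (DecidableEquality)
open import Relation.Binary.PropositionalEquality
  using (_≡_; _≢_; refl; sym; trans; cong; cong₂; subst; subst₂; module ≡-Reasoning)
open import Function.Bundles using (_⇔_; mk⇔; Equivalence; Bijection)
open import Function.Construct.Identity using (⤖-id)
open import Function.Properties.Bijection using (⤖⇒↔)

⊥△u≡u : ∀ {n} (u : Subset n) → ⊥ △ u ≡ u
⊥△u≡u []          = refl
⊥△u≡u (false ∷ u) = cong (false ∷_) (⊥△u≡u u)
⊥△u≡u (true ∷ u)  = cong (true ∷_) (⊥△u≡u u)

u△⊥≡u : ∀ {n} (u : Subset n) → u △ ⊥ ≡ u
u△⊥≡u []          = refl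
u△⊥≡u (false ∷ u) = cong (false ∷_) (u△⊥≡u u)
u△⊥≡u (true ∷ u)  = cong (true ∷_) (u△⊥≡u u)

u△u≡⊥ : ∀ {n} (u : Subset n) → u △ u ≡ ⊥
u△u≡⊥ []          = refl
u△u≡⊥ (false ∷ u) = cong (false ∷_) (u△u≡⊥ u)
u△u≡⊥ (true ∷ u)  = cong (false ∷_) (u△u≡⊥ u)

△-comm : ∀ {n} (u v : Subset n) → u △ v ≡ v △ u
△-comm []          []          = refl
△-comm (false ∷ u) (false ∷ v) = cong (false ∷_) (△-comm u v)
△-comm (false ∷ u) (true ∷ v)  = cong (true ∷_) (△-comm u v)
△-comm (true ∷ u)  (false ∷ v) = cong (true ∷_) (△-comm u v)
△-comm (true ∷ u)  (true ∷ v)  = cong (false ∷_) (△-comm u v)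

u△a△a≡u : ∀ {n} (u a : Subset n) → (u △ a) △ a ≡ u
u△a△a≡u []          []          = refl
u△a△a≡u (false ∷ u) (false ∷ a) = cong (false ∷_) (u△a△a≡u u a)
u△a△a≡u (false ∷ u) (true ∷ a)  = cong (false ∷_) (u△a△a≡u u a)
u△a△a≡u (true ∷ u)  (false ∷ a) = cong (true ∷_) (u△a△a≡u u a)
u△a△a≡u (true ∷ u)  (true ∷ a)  = cong (true ∷_) (u△a△a≡u u a)

u△v≡⊥⇒u≡v : ∀ {n} {u v : Subset n} → u △ v ≡ ⊥ → u ≡ v
u△v≡⊥⇒u≡v {u = u} {v} e = begin
  u             ≡⟨ sym (u△a△a≡u u v) ⟩
  (u △ v) △ v   ≡⟨ cong (_△ v) e ⟩
  ⊥ △ v         ≡⟨ ⊥△u≡u v ⟩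
  v             ∎
  where open ≡-Reasoning

∑ : ∀ n → (Subset n → ℕ) → ℕ
∑ zero    f = f []
∑ (suc n) f = ∑ n (λ v → f (false ∷ v)) + ∑ n (λ v → f (true ∷ v))

∑-cong : ∀ n {f g : Subset n → ℕ} → (∀ v → f v ≡ g v) → ∑ n f ≡ ∑ n g
∑-cong zero    f≗g = f≗g []
∑-cong (suc n) f≗g = cong₂ _+_ (∑-cong n (λ v → f≗g (false ∷ v))) (∑-cong n (λ v → f≗g (true ∷ v)))

∑-zero : ∀ n → ∑ n (λ _ → 0) ≡ 0
∑-zero zero    = refl
∑-zero (suc n) = cong₂ _+_ (∑-zero n) (∑-zero n)

∑-distrib-+ : ∀ n (f g : Subset n → ℕ) → ∑ n (λ v → f v + g v) ≡ ∑ n f + ∑ n g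
∑-distrib-+ zero    f g = refl
∑-distrib-+ (suc n) f g = begin
  ∑ n (λ v → f₀ v + g₀ v) + ∑ n (λ v → f₁ v + g₁ v)
    ≡⟨ cong₂ _+_ (∑-distrib-+ n f₀ g₀) (∑-distrib-+ n f₁ g₁) ⟩
  (∑ n f₀ + ∑ n g₀) + (∑ n f₁ + ∑ n g₁)
    ≡⟨ interchange (∑ n f₀) (∑ n g₀) (∑ n f₁) (∑ n g₁) ⟩
  (∑ n f₀ + ∑ n f₁) + (∑ n g₀ + ∑ n g₁)
    ∎
  where
  open ≡-Reasoning
  f₀ f₁ g₀ g₁ : Subset n → ℕ
  f₀ v = f (false ∷ v)
  f₁ v = f (true ∷ v)
  g₀ v = g (false ∷ v)
  g₁ v = g (true ∷ v)

∑-translate : ∀ n (f : Subset n → ℕ) (a : Subset n) → ∑ n (λ v → f (v △ a)) ≡ ∑ n f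
∑-translate zero    f []          = refl
∑-translate (suc n) f (false ∷ a) =
  cong₂ _+_ (∑-translate n (λ v → f (false ∷ v)) a) (∑-translate n (λ v → f (true ∷ v)) a)
∑-translate (suc n) f (true ∷ a)  =
  trans (cong₂ _+_ (∑-translate n (λ v → f (true ∷ v)) a) (∑-translate n (λ v → f (false ∷ v)) a))
        (+-comm (∑ n (λ v → f (true ∷ v))) _)

indicator : {P : Set} → Dec P → ℕ
indicator P? = if does P? then 1 else 0

indicator-cong : {P Q : Set} → P ⇔ Q → (P? : Dec P) (Q? : Dec Q) → indicator P? ≡ indicator Q?
indicator-cong P⇔Q (yes p)  (yes q)  = refl
indicator-cong P⇔Q (yes p)  (no ¬q)  = contradiction (Equivalence.to P⇔Q p) ¬q
indicator-cong P⇔Q (no ¬p)  (yes q)  = contradiction (Equivalence.from P⇔Q q) ¬p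
indicator-cong P⇔Q (no ¬p)  (no ¬q)  = refl

indicator-⊎ : {P Q : Set} → ¬ (P × Q) → (P? : Dec P) (Q? : Dec Q) →
              indicator (P? ⊎-dec Q?) ≡ indicator P? + indicator Q?
indicator-⊎ ¬P×Q (yes p) (yes q) = contradiction (p , q) ¬P×Q
indicator-⊎ ¬P×Q (yes p) (no ¬q) = refl
indicator-⊎ ¬P×Q (no ¬p) Q?      = refl

count : ∀ {n} {P : Subset n → Set} → Decidable P → ℕ
count {n} P? = ∑ n (λ v → indicator (P? v))

count≡0⊎∃ : ∀ {n} {P : Subset n → Set} (P? : Decidable P) → count P? ≡ 0 ⊎ ∃ P
count≡0⊎∃ {zero} P? with P? []
... | yes p = inj₂ ([] , p)
... | no _  = inj₁ refl
count≡0⊎∃ {suc n} P? with count≡0⊎∃ (λ v → P? (false ∷ v)) | count≡0⊎∃ (λ v → P? (true ∷ v))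
... | inj₁ e₀       | inj₁ e₁       = inj₁ (cong₂ _+_ e₀ e₁)
... | inj₂ (v , p)  | _             = inj₂ (false ∷ v , p)
... | inj₁ _        | inj₂ (v , p)  = inj₂ (true ∷ v , p)

record IsSubgroup {n} (P : Subset n → Set) : Set where
  field
    ⊥-closed : P ⊥
    △-closed : ∀ {u v} → P u → P v → P (u △ v)

IsSubgroup-restrict : ∀ {n} {P : Subset (suc n) → Set} → IsSubgroup P →
                      IsSubgroup (λ v → P (false ∷ v))
IsSubgroup-restrict H = record { ⊥-closed = ⊥-closed ; △-closed = △-closed }
  where open IsSubgroup H

module _ {n} {P : Subset (suc n) → Set} (P? : Decidable P) (H : IsSubgroup P) where
  open IsSubgroup H

  count-coset : ∀ {a} → P (true ∷ a) → count (λ v → P? (true ∷ v)) ≡ count (λ v → P? (false ∷ v))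
  count-coset {a} Pa = begin
    ∑ n (λ v → indicator (P? (true ∷ v)))
      ≡⟨ ∑-cong n (λ v → indicator-cong (coset v) (P? (true ∷ v)) (P? (false ∷ (v △ a)))) ⟩
    ∑ n (λ v → indicator (P? (false ∷ (v △ a))))
      ≡⟨ ∑-translate n (λ v → indicator (P? (false ∷ v))) a ⟩
    ∑ n (λ v → indicator (P? (false ∷ v)))
      ∎
    where
    open ≡-Reasoning
    coset : ∀ v → P (true ∷ v) ⇔ P (false ∷ (v △ a))
    coset v = mk⇔ (λ Pv → △-closed Pv Pa)
                  (λ Pv → subst (λ w → P (true ∷ w)) (u△a△a≡u v a) (△-closed Pv Pa))

count-subgroup : ∀ {n} {P : Subset n → Set} (P? : Decidable P) → IsSubgroup P →
                 ∃ λ k → count P? ≡ 2 ^ k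
count-subgroup {zero} P? H with P? []
... | yes _  = 0 , refl
... | no ¬p  = contradiction (IsSubgroup.⊥-closed H) ¬p
count-subgroup {suc n} P? H
  with count-subgroup (λ v → P? (false ∷ v)) (IsSubgroup-restrict H)
     | count≡0⊎∃ (λ v → P? (true ∷ v))
... | k , c₀≡2^k | inj₁ c₁≡0 = k , trans (cong₂ _+_ c₀≡2^k c₁≡0) (+-identityʳ (2 ^ k))
... | k , c₀≡2^k | inj₂ (a , Pa) =
  suc k , cong₂ _+_ c₀≡2^k (trans (count-coset P? H Pa) (trans c₀≡2^k (sym (+-identityʳ (2 ^ k)))))

_≟_ : ∀ {n} → DecidableEquality (Subset n)
_≟_ = ≡-dec _≟ᵇ_

_∈?_ : ∀ {n} (x : Subset n) (W : List (Subset n)) → Dec (x ∈ W)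
x ∈? W = DecMembership._∈?_ _≟_ x W

-- (b ∷ v) ≟ (c ∷ x) decides b ≡ c and v ≡ x, so each half is count (_≟ x) or a sum of zeros.
count-≡ : ∀ {n} (x : Subset n) → count (_≟ x) ≡ 1
count-≡ {zero}  []          = refl
count-≡ {suc n} (false ∷ x) = cong₂ _+_ (count-≡ x) (∑-zero n)
count-≡ {suc n} (true ∷ x)  = cong₂ _+_ (∑-zero n) (count-≡ x)

count-∈ : ∀ {n} {W : List (Subset n)} → Unique W → count (_∈? W) ≡ length W
count-∈ {n} {[]}    []          = ∑-zero n
count-∈ {n} {x ∷ W} (x∉W ∷ W!) = begin
  ∑ n (λ v → indicator (v ∈? (x ∷ W)))                   ≡⟨ ∑-cong n split ⟩
  ∑ n (λ v → indicator (v ≟ x) + indicator (v ∈? W))     ≡⟨ ∑-distrib-+ n _ _ ⟩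
  count (_≟ x) + count (_∈? W)                           ≡⟨ cong₂ _+_ (count-≡ x) (count-∈ W!) ⟩
  1 + length W                                           ∎
  where
  open ≡-Reasoning
  split : ∀ v → indicator (v ∈? (x ∷ W)) ≡ indicator (v ≟ x) + indicator (v ∈? W)
  split v = indicator-⊎ (λ { (refl , v∈W) → All¬⇒¬Any x∉W v∈W }) (v ≟ x) (v ∈? W)

subgroup-length : ∀ {n} {W : List (Subset n)} → Unique W → IsSubgroup (_∈ W) →
                  ∃ λ k → length W ≡ 2 ^ k
subgroup-length W! H with count-subgroup (_∈? _) H
... | k , e = k , trans (sym (count-∈ W!)) e

K≅⇒order : ∀ {m} G → K m ≅ G → m ≡ order G
K≅⇒order _ (f , _) = ↔⇒≡ (⤖⇒↔ f)

K≅⇒complete : ∀ {m} G → K m ≅ G → ∀ {i j} → i ≢ j → Adj G i j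
K≅⇒complete _ (f , preserves) {i} {j} i≢j
  with Bijection.strictlySurjective f i | Bijection.strictlySurjective f j
... | i′ , refl | j′ , refl = Equivalence.to (preserves i′ j′) (λ { refl → i≢j refl })

lookup-injective : ∀ {A : Set} {V : List A} → Unique V → ∀ {i j} → lookup V i ≡ lookup V j → i ≡ j
lookup-injective {V = _ ∷ _} _         {zero}  {zero}  _ = refl
lookup-injective {V = _ ∷ _} (x∉V ∷ _) {zero}  {suc j} e =
  ⊥-elim (All¬⇒¬Any x∉V (subst (_∈ _) (sym e) (∈-lookup j)))
lookup-injective {V = _ ∷ _} (x∉V ∷ _) {suc i} {zero}  e =
  ⊥-elim (All¬⇒¬Any x∉V (subst (_∈ _) e (∈-lookup i)))
lookup-injective {V = _ ∷ _} (_ ∷ V!)  {suc i} {suc j} e = cong suc (lookup-injective V! e)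

module _ {M : Set} (_⊕_ : M → M → M) where

  SumComplete : List M → Set
  SumComplete V = ∀ {x y} → x ∈ V → y ∈ V → x ≢ y → (x ⊕ y) ∈ V ⊎ (y ⊕ x) ∈ V

  complete⇒SumComplete : ∀ {V} (V! : Unique V) →
    (∀ {i j} → i ≢ j → Adj (sumGraph _⊕_ V V!) i j) → SumComplete V
  complete⇒SumComplete {V} _ complete {x} {y} x∈V y∈V x≢y =
    subst₂ (λ a b → (a ⊕ b) ∈ V ⊎ (b ⊕ a) ∈ V) (sym x≡V[i]) (sym y≡V[j]) (proj₂ (complete i≢j))
    where
    x≡V[i] : x ≡ lookup V (index x∈V)
    x≡V[i] = lookup-index x∈V
    y≡V[j] : y ≡ lookup V (index y∈V)
    y≡V[j] = lookup-index y∈V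
    i≢j : index x∈V ≢ index y∈V
    i≢j i≡j = x≢y (trans x≡V[i] (trans (cong (lookup V) i≡j) (sym y≡V[j])))

  K≅sumGraph : ∀ {V} (V! : Unique V) → SumComplete V → K (length V) ≅ sumGraph _⊕_ V V!
  K≅sumGraph {V} V! V-complete = ⤖-id _ , λ i j → mk⇔
    (λ i≢j → let V[i]≢V[j] = λ e → i≢j (lookup-injective V! e)
             in V[i]≢V[j] , V-complete (∈-lookup i) (∈-lookup j) V[i]≢V[j])
    (λ (V[i]≢V[j] , _) i≡j → V[i]≢V[j] (cong (lookup V) i≡j))

  K-isSumGraph⇔ : ∀ {m} → IsSumGraphOver _⊕_ (K m) ⇔
                  (Σ (List M) λ V → Unique V × m ≡ length V × SumComplete V)
  K-isSumGraph⇔ = mk⇔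
    (λ (V , V! , K≅G) → V , V! , K≅⇒order (sumGraph _⊕_ V V!) K≅G ,
                        complete⇒SumComplete V! (K≅⇒complete (sumGraph _⊕_ V V!) K≅G))
    (λ (V , V! , m≡|V| , V-complete) →
      V , V! , subst (λ l → K l ≅ sumGraph _⊕_ V V!) (sym m≡|V|) (K≅sumGraph V! V-complete))

IsSubgroup-resp : ∀ {n} {P Q : Subset n → Set} → (∀ {v} → P v → Q v) → (∀ {v} → Q v → P v) →
                  IsSubgroup P → IsSubgroup Q
IsSubgroup-resp P⇒Q Q⇒P H = record
  { ⊥-closed = P⇒Q ⊥-closed
  ; △-closed = λ Qu Qv → P⇒Q (△-closed (Q⇒P Qu) (Q⇒P Qv))
  }
  where open IsSubgroup H

SumComplete-△⇔IsSubgroup : ∀ {n} {V : List (Subset n)} → SumComplete _△_ V ⇔ IsSubgroup (_∈ ⊥ ∷ V)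
SumComplete-△⇔IsSubgroup {V = V} = mk⇔ to from
  where
  closed : SumComplete _△_ V → ∀ {u v} → u ∈ ⊥ ∷ V → v ∈ ⊥ ∷ V → (u △ v) ∈ ⊥ ∷ V
  closed _ {v = v} (here refl) v∈ = subst (_∈ ⊥ ∷ V) (sym (⊥△u≡u v)) v∈
  closed _ {u} (there u∈V) (here refl) = there (subst (_∈ V) (sym (u△⊥≡u u)) u∈V)
  closed complete {u} {v} (there u∈V) (there v∈V) with u ≟ v
  ... | yes refl = here (u△u≡⊥ u)
  ... | no u≢v with complete u∈V v∈V u≢v
  ...   | inj₁ u△v∈V = there u△v∈V
  ...   | inj₂ v△u∈V = there (subst (_∈ V) (△-comm v u) v△u∈V)
  cancel : ∀ {u v} → u ≢ v → (u △ v) ∈ ⊥ ∷ V → (u △ v) ∈ V ⊎ (v △ u) ∈ V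
  cancel u≢v (here u△v≡⊥) = contradiction (u△v≡⊥⇒u≡v u△v≡⊥) u≢v
  cancel u≢v (there u△v∈V) = inj₁ u△v∈V
  to : SumComplete _△_ V → IsSubgroup (_∈ ⊥ ∷ V)
  to complete = record { ⊥-closed = here refl ; △-closed = closed complete }
  from : IsSubgroup (_∈ ⊥ ∷ V) → SumComplete _△_ V
  from H u∈V v∈V u≢v = cancel u≢v (IsSubgroup.△-closed H (there u∈V) (there v∈V))

NearPowerOfTwo : ℕ → Set
NearPowerOfTwo m = Σ ℕ λ k → Σ ℕ λ ε → ε < 2 × m ≡ 2 ^ k ∸ ε

SumComplete-△⇒NearPowerOfTwo : ∀ {n} {V : List (Subset n)} → Unique V → SumComplete _△_ V →
                               NearPowerOfTwo (length V)
SumComplete-△⇒NearPowerOfTwo {V = V} V! complete = by-cases (⊥ ∈? V)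
  where
  H : IsSubgroup (_∈ ⊥ ∷ V)
  H = Equivalence.to SumComplete-△⇔IsSubgroup complete
  absorb : ∀ {x v} → x ∈ V → v ∈ x ∷ V → v ∈ V
  absorb x∈V (here refl) = x∈V
  absorb _   (there v∈V) = v∈V
  by-cases : Dec (⊥ ∈ V) → NearPowerOfTwo (length V)
  by-cases (yes ⊥∈V) = let k , |V|≡2^k = subgroup-length V! (IsSubgroup-resp (absorb ⊥∈V) there H)
                       in k , 0 , s≤s z≤n , |V|≡2^k
  by-cases (no ⊥∉V)  = let k , |⊥∷V|≡2^k = subgroup-length (¬Any⇒All¬ V ⊥∉V ∷ V!) H
                       in k , 1 , s≤s (s≤s z≤n) , cong (_∸ 1) |⊥∷V|≡2^k

subsets : ∀ n → List (Subset n)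
subsets zero    = [ [] ]
subsets (suc n) = map (false ∷_) (subsets n) ++ map (true ∷_) (subsets n)

length-subsets : ∀ n → length (subsets n) ≡ 2 ^ n
length-subsets zero    = refl
length-subsets (suc n) = begin
  length (map (false ∷_) S ++ map (true ∷_) S)
    ≡⟨ length-++ (map (false ∷_) S) ⟩
  length (map (false ∷_) S) + length (map (true ∷_) S)
    ≡⟨ cong₂ _+_ (length-map _ S) (length-map _ S) ⟩
  length S + length S
    ≡⟨ cong₂ _+_ (length-subsets n) (trans (length-subsets n) (sym (+-identityʳ _))) ⟩
  2 ^ n + (2 ^ n + 0)
    ∎
  where
  open ≡-Reasoning
  S = subsets n

∈-subsets : ∀ {n} (v : Subset n) → v ∈ subsets n
∈-subsets []          = here refl
∈-subsets (false ∷ v) = ∈-++⁺ˡ (∈-map⁺ (false ∷_) (∈-subsets v))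
∈-subsets (true ∷ v)  = ∈-++⁺ʳ (map (false ∷_) (subsets _)) (∈-map⁺ (true ∷_) (∈-subsets v))

subsets-unique : ∀ n → Unique (subsets n)
subsets-unique zero    = [] ∷ []
subsets-unique (suc n) =
  Unique.++⁺ (Unique.map⁺ ∷-injectiveʳ (subsets-unique n))
             (Unique.map⁺ ∷-injectiveʳ (subsets-unique n))
             disjoint
  where
  disjoint : ∀ {v} → ¬ (v ∈ map (false ∷_) (subsets n) × v ∈ map (true ∷_) (subsets n))
  disjoint (v∈S₀ , v∈S₁) with ∈-map⁻ (false ∷_) v∈S₀ | ∈-map⁻ (true ∷_) v∈S₁
  ... | _ , _ , refl | _ , _ , ()

subsets≡⊥∷ : ∀ n → ∃ λ L → subsets n ≡ ⊥ ∷ L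
subsets≡⊥∷ zero = [] , refl
subsets≡⊥∷ (suc n) with subsets n | subsets≡⊥∷ n
... | .(⊥ ∷ L) | L , refl = _ , refl

NearPowerOfTwo⇒SumComplete-△ : ∀ {m} → NearPowerOfTwo m →
  Σ ℕ λ n → Σ (List (Subset n)) λ V → Unique V × m ≡ length V × SumComplete _△_ V
NearPowerOfTwo⇒SumComplete-△ (k , 0 , _ , refl) =
  k , subsets k , subsets-unique k , sym (length-subsets k) ,
  λ {x} {y} _ _ _ → inj₁ (∈-subsets (x △ y))
NearPowerOfTwo⇒SumComplete-△ (k , 1 , _ , refl)
  with subsets k | subsets-unique k | length-subsets k | ∈-subsets {k} | subsets≡⊥∷ k
... | .(⊥ ∷ L) | _ ∷ L! | |⊥∷L|≡2^k | ∈⊥∷L | L , refl =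
  k , L , L! , cong (_∸ 1) (sym |⊥∷L|≡2^k) ,
  Equivalence.from SumComplete-△⇔IsSubgroup
    (record { ⊥-closed = here refl ; △-closed = λ _ _ → ∈⊥∷L _ })
NearPowerOfTwo⇒SumComplete-△ (k , suc (suc _) , s≤s (s≤s ()) , _)

mainTheorem2 : (m : ℕ) → m ≥ 1 →
    (Σ ℕ (λ n → IsSumGraphOver (_△_ {n}) (K m)))
      ⇔ (Σ ℕ λ k → Σ ℕ λ ε → ε < 2 × m ≡ 2 ^ k ∸ ε)
mainTheorem2 m _ = mk⇔
  (λ (n , K-sumGraph) →
    let V , V! , m≡|V| , V-complete = Equivalence.to (K-isSumGraph⇔ _△_) K-sumGraph
    in subst NearPowerOfTwo (sym m≡|V|) (SumComplete-△⇒NearPowerOfTwo V! V-complete))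
  (λ m≈2^k →
    let n , V-complete = NearPowerOfTwo⇒SumComplete-△ m≈2^k
    in n , Equivalence.from (K-isSumGraph⇔ _△_) V-complete)
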